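{- Let $a,n$ be positive integers with $a<n$ and $\gcd(a,n)=1$. For every $k=1,\dots,n-1$, $$\gcd\left(\left\lceil\frac{k(n-a)}{n}\right\rceil,k\right)=\gcd\left(\left\lceil\frac{k(n-a)}{n}\right\rceil,\left\lfloor\frac{ka}{n}\right\rfloor\right)=\gcd\left(\left\lfloor\frac{ka}{n}\right\rfloor,k\right).$$ Furthermore, if $n=p$ is prime, then for every $k=1,\dots,p-1$, $$\gcd\left(\left\lceil\frac{k(p-a)}{p}\right\rceil,k\right)=\gcd(ka \bmod p,\,k).$$
   Context: $ka \bmod p$ denotes the least nonnegative residue of $ka$ modulo $p$. -}

module Defs where

open import Data.Nat using (ℕ; _+_; _∸_; NonZero)
open import Data.Nat.DivMod using (_/_)

⌈_/_⌉ : (m n : ℕ) → .{{NonZero n}} → ℕ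
⌈ m / n ⌉ = (m + (n ∸ 1)) / n

{-# OPTIONS --safe #-}
module Submission where

open import Defs
open import Data.Nat using (ℕ; suc; _+_; _*_; _∸_; _≤_; _<_; NonZero; s≤s; s≤s⁻¹)
open import Data.Nat.Properties
open import Data.Nat.DivMod
open import Data.Nat.Divisibility
open import Data.Nat.GCD
open import Data.Nat.Coprimality using (Coprime; coprime-divisor; prime⇒coprime)
open import Data.Nat.Primality using (Prime)
open import Data.Product using (_×_; _,_)
open import Relation.Binary.PropositionalEquality

-- With q = ⌊ka/n⌋ and r = ka mod n one has ka = qn + r and k(n − a) + r = (k − q)n,
-- so ⌈k(n − a)/n⌉ = k − q. The three gcds of the first claim are then
-- gcd(k − q, k), gcd(k − q, q) and gcd(q, k), equal by one Euclid step each way.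
-- For n prime and 0 < k < n, k is prime to n, and a common divisor of k (hence
-- of ka = qn + r) divides r iff it divides qn iff it divides q.

gcd[m,m+n]≡gcd[m,n] : ∀ m n → gcd m (m + n) ≡ gcd m n
gcd[m,m+n]≡gcd[m,n] m n = GCD.unique (gcd-GCD m (m + n)) (GCD.step (gcd-GCD m n))

gcd[k∸q,k]≡gcd[k∸q,q] : ∀ {q k} → q ≤ k → gcd (k ∸ q) k ≡ gcd (k ∸ q) q
gcd[k∸q,k]≡gcd[k∸q,q] {q} {k} q≤k = begin
  gcd (k ∸ q) k             ≡⟨ cong (gcd (k ∸ q)) (m∸n+n≡m q≤k) ⟨
  gcd (k ∸ q) (k ∸ q + q)   ≡⟨ gcd[m,m+n]≡gcd[m,n] (k ∸ q) q ⟩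
  gcd (k ∸ q) q             ∎
  where open ≡-Reasoning

gcd[k∸q,q]≡gcd[q,k] : ∀ {q k} → q ≤ k → gcd (k ∸ q) q ≡ gcd q k
gcd[k∸q,q]≡gcd[q,k] {q} {k} q≤k = begin
  gcd (k ∸ q) q             ≡⟨ gcd-comm (k ∸ q) q ⟩
  gcd q (k ∸ q)             ≡⟨ gcd[m,m+n]≡gcd[m,n] q (k ∸ q) ⟨
  gcd q (q + (k ∸ q))       ≡⟨ cong (gcd q) (m+[n∸m]≡n q≤k) ⟩
  gcd q k                   ∎
  where open ≡-Reasoning

m+r≡t*n⇒⌈m/n⌉≡t : ∀ {m r t n} .{{_ : NonZero n}} → m + r ≡ t * n → r < n → ⌈ m / n ⌉ ≡ t
m+r≡t*n⇒⌈m/n⌉≡t {m} {r} {t} {n@(suc n-1)} m+r≡t*n r<n = begin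
  (m + n-1) / n             ≡⟨ /-congˡ (cong (m +_) (m+[n∸m]≡n r≤n-1)) ⟨
  (m + (r + s)) / n         ≡⟨ /-congˡ (+-assoc m r s) ⟨
  (m + r + s) / n           ≡⟨ /-congˡ (cong (_+ s) m+r≡t*n) ⟩
  (t * n + s) / n           ≡⟨ +-distrib-/-∣ˡ s (divides-refl t) ⟩
  t * n / n + s / n         ≡⟨ cong₂ _+_ (m*n/n≡m t n) (m<n⇒m/n≡0 (s≤s (m∸n≤m n-1 r))) ⟩
  t + 0                     ≡⟨ +-identityʳ t ⟩
  t                         ∎
  where
  open ≡-Reasoning
  r≤n-1 : r ≤ n-1
  r≤n-1 = s≤s⁻¹ r<n
  s : ℕ
  s = n-1 ∸ r

m≤k*n⇒m/n≤k : ∀ {m k n} .{{_ : NonZero n}} → m ≤ k * n → m / n ≤ k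
m≤k*n⇒m/n≤k {m} {k} {n} m≤k*n = ≤-trans (/-monoˡ-≤ n m≤k*n) (≤-reflexive (m*n/n≡m k n))

[k*n∸m]+m%n≡[k∸m/n]*n : ∀ {m k n} .{{_ : NonZero n}} → m ≤ k * n →
                        (k * n ∸ m) + m % n ≡ (k ∸ m / n) * n
[k*n∸m]+m%n≡[k∸m/n]*n {m} {k} {n} m≤k*n = begin
  (k * n ∸ m) + m % n               ≡⟨ cong (k * n ∸ m +_) (m%n≡m∸m/n*n m n) ⟩
  (k * n ∸ m) + (m ∸ m / n * n)     ≡⟨ +-∸-assoc (k * n ∸ m) (m/n*n≤m m n) ⟨
  (k * n ∸ m) + m ∸ m / n * n       ≡⟨ cong (_∸ m / n * n) (m∸n+n≡m m≤k*n) ⟩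
  k * n ∸ m / n * n                 ≡⟨ *-distribʳ-∸ n k (m / n) ⟨
  (k ∸ m / n) * n                   ∎
  where open ≡-Reasoning

⌈[k*n∸m]/n⌉≡k∸m/n : ∀ {m k n} .{{_ : NonZero n}} → m ≤ k * n → ⌈ (k * n ∸ m) / n ⌉ ≡ k ∸ m / n
⌈[k*n∸m]/n⌉≡k∸m/n {m} {k} {n} m≤k*n =
  m+r≡t*n⇒⌈m/n⌉≡t ([k*n∸m]+m%n≡[k∸m/n]*n m≤k*n) (m%n<n m n)

⌈k*[n∸a]/n⌉≡k∸k*a/n : ∀ k {a n} .{{_ : NonZero n}} → a ≤ n → ⌈ k * (n ∸ a) / n ⌉ ≡ k ∸ k * a / n
⌈k*[n∸a]/n⌉≡k∸k*a/n k {a} {n} a≤n = begin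
  ⌈ k * (n ∸ a) / n ⌉       ≡⟨ cong (λ x → ⌈ x / n ⌉) (*-distribˡ-∸ k n a) ⟩
  ⌈ (k * n ∸ k * a) / n ⌉   ≡⟨ ⌈[k*n∸m]/n⌉≡k∸m/n (*-monoʳ-≤ k a≤n) ⟩
  k ∸ k * a / n             ∎
  where open ≡-Reasoning

gcd[m/n,k]≡gcd[m%n,k] : ∀ {m n k} .{{_ : NonZero n}} → k ∣ m → Coprime n k →
                        gcd (m / n) k ≡ gcd (m % n) k
gcd[m/n,k]≡gcd[m%n,k] {m} {n} {k} k∣m n⊥k = gcd-universality forwards backwards
  where
  m≡r+q*n : m ≡ m % n + m / n * n
  m≡r+q*n = m≡m%n+[m/n]*n m n

  forwards : ∀ {d} → d ∣ m % n × d ∣ k → d ∣ gcd (m / n) k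
  forwards {d} (d∣r , d∣k) = gcd-greatest (coprime-divisor d⊥n d∣n*q) d∣k
    where
    d⊥n : Coprime d n
    d⊥n (e∣d , e∣n) = n⊥k (e∣n , ∣-trans e∣d d∣k)
    d∣n*q : d ∣ n * (m / n)
    d∣n*q = subst (d ∣_) (*-comm (m / n) n)
      (∣m+n∣m⇒∣n (subst (d ∣_) m≡r+q*n (∣-trans d∣k k∣m)) d∣r)

  backwards : ∀ {d} → d ∣ gcd (m / n) k → d ∣ m % n × d ∣ k
  backwards {d} d∣g = d∣r , d∣k
    where
    d∣k : d ∣ k
    d∣k = ∣-trans d∣g (gcd[m,n]∣n (m / n) k)
    d∣q*n : d ∣ m / n * n
    d∣q*n = ∣m⇒∣m*n n (∣-trans d∣g (gcd[m,n]∣m (m / n) k))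
    d∣r : d ∣ m % n
    d∣r = ∣m+n∣m⇒∣n (subst (d ∣_) (trans m≡r+q*n (+-comm (m % n) _)) (∣-trans d∣k k∣m)) d∣q*n

prime⇒coprime[p,k] : ∀ {p k} → Prime p → 1 ≤ k → k ≤ p ∸ 1 → Coprime p k
prime⇒coprime[p,k] {suc _} {suc _} p-prime _ k≤p∸1 = prime⇒coprime p-prime (s≤s k≤p∸1)

proposition5 : (a n : ℕ) → .{{_ : NonZero n}} → 1 ≤ a → a < n → gcd a n ≡ 1 →
    ((k : ℕ) → 1 ≤ k → k ≤ n ∸ 1 →
      (gcd ⌈ k * (n ∸ a) / n ⌉ k ≡ gcd ⌈ k * (n ∸ a) / n ⌉ ((k * a) / n))
      × (gcd ⌈ k * (n ∸ a) / n ⌉ ((k * a) / n) ≡ gcd ((k * a) / n) k))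
    × (Prime n → (k : ℕ) → 1 ≤ k → k ≤ n ∸ 1 →
      gcd ⌈ k * (n ∸ a) / n ⌉ k ≡ gcd ((k * a) % n) k)
proposition5 a n _ a<n _ = euclid , prime-case
  where
  q≤k : ∀ k → k * a / n ≤ k
  q≤k k = m≤k*n⇒m/n≤k (*-monoʳ-≤ k (<⇒≤ a<n))

  euclid : (k : ℕ) → 1 ≤ k → k ≤ n ∸ 1 →
    (gcd ⌈ k * (n ∸ a) / n ⌉ k ≡ gcd ⌈ k * (n ∸ a) / n ⌉ ((k * a) / n))
    × (gcd ⌈ k * (n ∸ a) / n ⌉ ((k * a) / n) ≡ gcd ((k * a) / n) k)
  euclid k _ _ rewrite ⌈k*[n∸a]/n⌉≡k∸k*a/n k (<⇒≤ a<n) =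
    gcd[k∸q,k]≡gcd[k∸q,q] (q≤k k) , gcd[k∸q,q]≡gcd[q,k] (q≤k k)

  prime-case : Prime n → (k : ℕ) → 1 ≤ k → k ≤ n ∸ 1 →
    gcd ⌈ k * (n ∸ a) / n ⌉ k ≡ gcd ((k * a) % n) k
  prime-case n-prime k 1≤k k≤n∸1 rewrite ⌈k*[n∸a]/n⌉≡k∸k*a/n k (<⇒≤ a<n) = begin
    gcd (k ∸ k * a / n) k           ≡⟨ gcd[k∸q,k]≡gcd[k∸q,q] (q≤k k) ⟩
    gcd (k ∸ k * a / n) (k * a / n) ≡⟨ gcd[k∸q,q]≡gcd[q,k] (q≤k k) ⟩
    gcd (k * a / n) k               ≡⟨ gcd[m/n,k]≡gcd[m%n,k] (∣m⇒∣m*n a ∣-refl) n⊥k ⟩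
    gcd (k * a % n) k               ∎
    where
    open ≡-Reasoning
    n⊥k : Coprime n k
    n⊥k = prime⇒coprime[p,k] n-prime 1≤k k≤n∸1
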